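{- Let $k,s,q$ be positive integers and for $(t,\eta,\xi)\in\mathbb{P}^3$ let $$g_{k,s}(t,\eta,\xi)=\sum_{\deg Y\le k-1}\sum_{\deg Z\le s-1}E(tYZ)\sum_{\deg U\le s-1}E(\eta YU)\sum_{\deg V\le s-1}E(\xi YV).$$ Then $g_{k,s}(t,\eta,\xi)=2^{3s+k-r(D^{[s;s;s]\times k}(t,\eta,\xi))}$ and $$\int_{\mathbb{P}\times\mathbb{P}\times\mathbb{P}}g_{k,s}^q(t,\eta,\xi)\,dt\,d\eta\,d\xi=2^{(3s+k)q}\cdot2^{ -3k-3s+3}\sum_{i=0}^{\min(3s,k)}\Gamma_i^{[s;s;s]\times k}2^{ -qi}.$$
   Context: $\mathbb{K}=\mathbb{F}_2((T^{ -1}))$; $\mathbb{P}=\{\sum_{i\ge1}\alpha_iT^{ -i}\}$ the unit interval with Haar measure of total mass $1$; $E(t)=(-1)^{\alpha_1}$, $\alpha_1$ the coefficient of $T^{ -1}$. Sums run over polynomials in $\mathbb{F}_2[T]$ with the given degree bounds (zero included). For $t=\sum\alpha_iT^{ -i}$, $\eta=\sum\beta_iT^{ -i}$, $\xi=\sum\gamma_iT^{ -i}$, $D^{[s;s;s]\times k}(t,\eta,\xi)$ is the $3s\times k$ matrix formed by stacking $(\alpha_{i+j-1})$, $(\beta_{i+j-1})$, $(\gamma_{i+j-1})$ ($1\le i\le s$, $1\le j\le k$); $r$ is rank over $\mathbb{F}_2$. $\Gamma_i^{[s;s;s]\times k}$ is the number of such $3s\times k$ matrices (three independent $s\times k$ persymmetric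 blocks over $\mathbb{F}_2$) of rank $i$. -}

module Defs where

open import Data.Bool using (Bool; true; false; _∧_; _∨_; _xor_; not; if_then_else_)
open import Data.Nat using (ℕ; zero; suc; _+_; _*_; _∸_; _^_; _⊔_; _⊓_; _≡ᵇ_)
open import Data.Nat.Properties using (m^n≢0)
open import Data.Fin using (Fin; toℕ)
open import Data.List using (List; []; _∷_; map; foldr; concatMap; upTo; length; filter)
open import Data.Vec as V using (Vec)
open import Data.Integer as ℤ using (ℤ; +_)
open import Data.Rational as ℚ using (ℚ; 0ℚ)

-- Elements of the unit interval ℙ of 𝕂 = F₂((T⁻¹)).
-- A point t = Σ_{i≥1} α_i T^{-i} is represented by its coefficient
-- sequence, SHIFTED by one:   t n = α_{n+1}   (n = 0,1,2,...).
𝕡 : Set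
𝕡 = ℕ → Bool

-- Polynomials over F₂ as coefficient lists (head = constant term).
Poly : Set
Poly = List Bool

addP : Poly → Poly → Poly
addP []      q       = q
addP (a ∷ p) []      = a ∷ p
addP (a ∷ p) (b ∷ q) = (a xor b) ∷ addP p q

mulP : Poly → Poly → Poly
mulP []      q = []
mulP (a ∷ p) q = addP (map (a ∧_) q) (false ∷ mulP p q)

-- The polynomials of degree ≤ d-1 (zero included) are exactly the
-- coefficient vectors of length d.
allBits : (n : ℕ) → List (Vec Bool n)
allBits zero    = V.[] ∷ []
allBits (suc n) = concatMap (λ v → (false V.∷ v) ∷ (true V.∷ v) ∷ []) (allBits n)

poly : ∀ {n} → Vec Bool n → Poly
poly = V.toList

-- For P = a + T·P' one has  coef_{T⁻¹}(tP) = a·α₁ + coef_{T⁻¹}(t' P')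
-- with t' = Σ α_{i+1} T^{-i}  (the polynomial part of T·t contributes
-- no negative powers).
coefT⁻¹ : 𝕡 → Poly → Bool
coefT⁻¹ t []      = false
coefT⁻¹ t (a ∷ p) = (a ∧ t 0) xor coefT⁻¹ (λ n → t (suc n)) p

E : 𝕡 → Poly → ℤ
E t p = if coefT⁻¹ t p then ℤ.- (+ 1) else + 1

sumℤ : List ℤ → ℤ
sumℤ = foldr ℤ._+_ (+ 0)

Σpoly : (d : ℕ) → (Poly → ℤ) → ℤ
Σpoly d f = sumℤ (map (λ v → f (poly v)) (allBits d))

g : (k s : ℕ) → 𝕡 → 𝕡 → 𝕡 → ℤ
g k s t η ξ =
  Σpoly k λ Y → Σpoly s λ Z →
    E t (mulP Y Z) ℤ.* (Σpoly s λ U → E η (mulP Y U) ℤ.* (Σpoly s λ V → E ξ (mulP Y V)))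

Mat : ℕ → ℕ → Set
Mat m n = Vec (Vec Bool n) m

-- s×k persymmetric block (α_{i+j-1})_{1≤i≤s,1≤j≤k}; with our shifted
-- indexing α_{i+j-1} = t (i' + j') for 0-based i', j'.
hankel : (s k : ℕ) → 𝕡 → Mat s k
hankel s k t = V.tabulate λ (i : Fin s) → V.tabulate λ (j : Fin k) → t (toℕ i + toℕ j)

D : (s k : ℕ) → 𝕡 → 𝕡 → 𝕡 → Mat (s + s + s) k
D s k t η ξ = (hankel s k t V.++ hankel s k η) V.++ hankel s k ξ

zeroV : ∀ {n} → Vec Bool n
zeroV = V.replicate _ false

combo : ∀ {m n} → Mat m n → Vec Bool m → Vec Bool n
combo V.[]       V.[]       = zeroV
combo (r V.∷ rs) (b V.∷ bs) = if b then V.zipWith _xor_ r (combo rs bs) else combo rs bs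

isZeroV : ∀ {n} → Vec Bool n → Bool
isZeroV v = V.foldr _ (λ b acc → not b ∧ acc) true v

nonempty : ∀ {m} → Vec Bool m → Bool
nonempty v = V.foldr _ _∨_ false v

subsel : ∀ {m} → Vec Bool m → Vec Bool m → Bool
subsel τ σ = V.foldr _ _∧_ true (V.zipWith (λ a b → not a ∨ b) τ σ)

allL : ∀ {A : Set} → (A → Bool) → List A → Bool
allL p = foldr (λ x acc → p x ∧ acc) true

independent : ∀ {m n} → Mat m n → Vec Bool m → Bool
independent {m} M σ =
  allL (λ τ → not (subsel τ σ ∧ nonempty τ) ∨ not (isZeroV (combo M τ))) (allBits m)

count : ∀ {m} → Vec Bool m → ℕ
count v = V.foldr _ (λ b acc → (if b then 1 else 0) + acc) 0 v

rank : ∀ {m n} → Mat m n → ℕ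
rank {m} M = foldr _⊔_ 0 (map (λ σ → if independent M σ then count σ else 0) (allBits m))

-- Points of ℙ whose coefficients beyond the first N vanish
-- (canonical representatives of the level-N cylinder sets).
ext : ∀ {N} → Vec Bool N → 𝕡
ext {zero}  V.[]      n       = false
ext {suc N} (b V.∷ v) zero    = b
ext {suc N} (b V.∷ v) (suc n) = ext v n

-- Γ_i^{[s;s;s]×k}: number of 3s×k matrices made of three independent
-- s×k persymmetric blocks over F₂ having rank i.  Such a block is
-- determined by its k+s-1 entries α_1..α_{k+s-1}.
Γ : (s k i : ℕ) → ℕ
Γ s k i = length (filter (λ x → Data.Nat._≟_ (rank x) i)
  (concatMap (λ a → concatMap (λ b → map (λ c → D s k (ext a) (ext b) (ext c))
     (allBits (k + s ∸ 1))) (allBits (k + s ∸ 1))) (allBits (k + s ∸ 1))))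

sumℚ : List ℚ → ℚ
sumℚ = foldr ℚ._+_ 0ℚ

2^-_ : ℕ → ℚ
2^- n = ℚ._/_ (+ 1) (2 ^ n) {{m^n≢0 2 n}}

ℤ→ℚ : ℤ → ℚ
ℤ→ℚ z = ℚ._/_ z 1

ℕ→ℚ : ℕ → ℚ
ℕ→ℚ n = ℚ._/_ (+ n) 1

-- Haar integral over ℙ×ℙ×ℙ (total mass 1) of a function that depends
-- only on the first N coefficients of each argument: every level-N
-- cylinder has measure 2^{-N} in each factor, so the integral is the
-- average over the 2^{3N} cylinders.
∫ℙ³[_] : (N : ℕ) → (𝕡 → 𝕡 → 𝕡 → ℚ) → ℚ
∫ℙ³[ N ] f = 2^- (3 * N) ℚ.*
  sumℚ (concatMap (λ a → concatMap (λ b → map (λ c → f (ext a) (ext b) (ext c))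
     (allBits N)) (allBits N)) (allBits N))

{-# OPTIONS --safe #-}
-- Writing E(tYZ) = (-1)^⟨Z, H_t Y⟩, where H_t is the s×k Hankel matrix of t, each inner sum over
-- polynomials of degree < s is 2^s or 0 according as H_t Y vanishes, so g = 2^{3s}·#ker D.
-- Double counting Σ_y Σ_τ (-1)^{τ·D y} gives 2^{3s}·#ker D = 2^k·#{τ : τᵀD = 0}, and this left kernel
-- has 2^{3s - rank D} elements by Gaussian elimination.
-- As g depends only on the first k+s-1 coefficients of t, η, ξ, the integral is an average over the
-- 2^{3(k+s-1)} cylinders of that level, and grouping them by the rank of D gives the sum over Γᵢ.
module Submission where

open import Defs
open import Data.Nat using (ℕ; _+_; _*_; _∸_; _^_; _≤_; _⊓_; suc)
open import Data.Integer as ℤ using (+_)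
open import Data.Rational as ℚ using (ℚ)
open import Data.List using (map; upTo)
open import Data.Product using (_×_)
open import Relation.Binary.PropositionalEquality using (_≡_)

open import Algebra.Bundles using (CommutativeMonoid; CommutativeSemigroup)
open import Algebra.Structures using (IsCommutativeMonoid)
open import Data.Bool using (Bool; true; false; _∧_; _∨_; _xor_; not; if_then_else_)
open import Data.Bool.Properties
  using (xor-assoc; xor-comm; xor-identityˡ; xor-identityʳ; xor-same; ∧-comm; xor-∧-commutativeRing)
import Data.Bool.Properties as 𝔹
open import Data.Empty using (⊥-elim)
open import Data.Fin using (Fin; toℕ) renaming (zero to zeroF)
open import Data.Fin.Properties using (toℕ<n)
open import Data.Fin.Subset using (_∩_)
import Data.Integer.Properties as ℤ
open import Data.List using (List; []; _∷_; foldr; concatMap; _++_; length; filter; applyUpTo)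
import Data.List.Properties as List
open import Data.List.Membership.Propositional using (_∈_)
open import Data.List.Membership.Propositional.Properties using (∈-concatMap⁺)
open import Data.List.Relation.Unary.All.Properties using (applyUpTo⁺₁)
open import Data.List.Relation.Unary.Any as Any using (here; there)
open import Data.Maybe using (just; nothing)
open import Data.Nat using (zero; _<_; _⊔_; z≤n; s≤s; _≡ᵇ_; _≟_)
import Data.Nat.Coprimality as Coprime
open import Data.Nat.Properties
open import Data.Nat.Tactic.RingSolver using () renaming (ring to ℕ-ring)
open import Data.Product using (∃; _,_)
open import Data.Rational using (mkℚ)
import Data.Rational.Properties as ℚ
open import Data.Sum using (_⊎_; inj₁; inj₂)
open import Data.Vec as Vec using (Vec; []; _∷_; zipWith)
import Data.Vec.Properties as Vec
open import Function using (_∘_; id)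
open import Level using (0ℓ)
open import Relation.Binary.PropositionalEquality
  using (refl; sym; trans; cong; cong₂; subst; subst₂; module ≡-Reasoning)
open import Relation.Nullary using (Dec; yes; no)
open import Relation.Nullary.Decidable using (map′; _⊎-dec_; isNo)
open import Relation.Unary using (Pred; Decidable)
open import Tactic.RingSolver using (solve-∀)
open import Tactic.RingSolver.Core.AlmostCommutativeRing using (AlmostCommutativeRing; fromCommutativeRing)

open import Algebra.Properties.CommutativeSemigroup
  (CommutativeMonoid.commutativeSemigroup ℚ.*-1-commutativeMonoid) using (x∙yz≈y∙xz)

variable
  A B C : Set
  k m n : ℕ

𝔽₂ : AlmostCommutativeRing 0ℓ 0ℓ
𝔽₂ = fromCommutativeRing xor-∧-commutativeRing λ { false → just refl ; true → nothing }

xor-∧-interchange : ∀ a b c x y → (a xor b) ∧ c xor (x xor y) ≡ (a ∧ c xor x) xor (b ∧ c xor y)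
xor-∧-interchange = solve-∀ 𝔽₂

infixl 6 _⊕_
_⊕_ : Vec Bool n → Vec Bool n → Vec Bool n
_⊕_ = zipWith _xor_

⊕-comm : (u v : Vec Bool n) → u ⊕ v ≡ v ⊕ u
⊕-comm = Vec.zipWith-comm xor-comm

⊕-assoc : (u v w : Vec Bool n) → (u ⊕ v) ⊕ w ≡ u ⊕ (v ⊕ w)
⊕-assoc = Vec.zipWith-assoc xor-assoc

⊕-identityˡ : (v : Vec Bool n) → zeroV ⊕ v ≡ v
⊕-identityˡ = Vec.zipWith-identityˡ xor-identityˡ

⊕-identityʳ : (v : Vec Bool n) → v ⊕ zeroV ≡ v
⊕-identityʳ = Vec.zipWith-identityʳ xor-identityʳ

⊕-self : (v : Vec Bool n) → v ⊕ v ≡ zeroV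
⊕-self []      = refl
⊕-self (a ∷ v) = cong₂ _∷_ (xor-same a) (⊕-self v)

⊕-cancelˡ : (u v : Vec Bool n) → u ⊕ (u ⊕ v) ≡ v
⊕-cancelˡ u v = trans (sym (⊕-assoc u u v)) (trans (cong (_⊕ v) (⊕-self u)) (⊕-identityˡ v))

⊕-interchange : (a b c d : Vec Bool n) → (a ⊕ b) ⊕ (c ⊕ d) ≡ (a ⊕ c) ⊕ (b ⊕ d)
⊕-interchange []      []      []      []      = refl
⊕-interchange (a ∷ _) (b ∷ _) (c ∷ _) (d ∷ _) = cong₂ _∷_ (step a b c d) (⊕-interchange _ _ _ _)
  where
  step : ∀ a b c d → (a xor b) xor (c xor d) ≡ (a xor c) xor (b xor d)
  step = solve-∀ 𝔽₂

isZeroV-zeroV : ∀ n → isZeroV (zeroV {n}) ≡ true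
isZeroV-zeroV zero    = refl
isZeroV-zeroV (suc n) = isZeroV-zeroV n

isZeroV⇒≡zeroV : (v : Vec Bool n) → isZeroV v ≡ true → v ≡ zeroV
isZeroV⇒≡zeroV []          _  = refl
isZeroV⇒≡zeroV (false ∷ v) eq = cong (false ∷_) (isZeroV⇒≡zeroV v eq)

isZeroV-⊕⇒≡ : (u v : Vec Bool n) → isZeroV (u ⊕ v) ≡ true → u ≡ v
isZeroV-⊕⇒≡ u v eq = begin
  u                ≡⟨ sym (⊕-identityʳ u) ⟩
  u ⊕ zeroV        ≡⟨ cong (u ⊕_) (sym (⊕-self v)) ⟩
  u ⊕ (v ⊕ v)      ≡⟨ sym (⊕-assoc u v v) ⟩
  (u ⊕ v) ⊕ v      ≡⟨ cong (_⊕ v) (isZeroV⇒≡zeroV (u ⊕ v) eq) ⟩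
  zeroV ⊕ v        ≡⟨ ⊕-identityˡ v ⟩
  v                ∎
  where open ≡-Reasoning

dot : Vec Bool n → Vec Bool n → Bool
dot []      []      = false
dot (a ∷ u) (b ∷ v) = (a ∧ b) xor dot u v

dot-comm : (u v : Vec Bool n) → dot u v ≡ dot v u
dot-comm []      []      = refl
dot-comm (a ∷ u) (b ∷ v) = cong₂ _xor_ (∧-comm a b) (dot-comm u v)

dot-zeroˡ : (v : Vec Bool n) → dot zeroV v ≡ false
dot-zeroˡ []      = refl
dot-zeroˡ (_ ∷ v) = dot-zeroˡ v

dot-⊕ˡ : (u v w : Vec Bool n) → dot (u ⊕ v) w ≡ dot u w xor dot v w
dot-⊕ˡ []      []      []      = refl
dot-⊕ˡ (a ∷ u) (b ∷ v) (c ∷ w) = trans (cong ((a xor b) ∧ c xor_) (dot-⊕ˡ u v w)) (xor-∧-interchange a b c _ _)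

infixr 7 _·_
_·_ : Mat m n → Vec Bool n → Vec Bool m
M · y = Vec.map (λ r → dot r y) M

·-++ : (M : Mat m k) (N : Mat n k) (y : Vec Bool k) → (M Vec.++ N) · y ≡ M · y Vec.++ N · y
·-++ M N y = Vec.map-++ (λ r → dot r y) M N

combo-zero : (M : Mat m n) → combo M zeroV ≡ zeroV
combo-zero []      = refl
combo-zero (_ ∷ M) = combo-zero M

combo-⊕ : (M : Mat m n) (τ σ : Vec Bool m) → combo M (τ ⊕ σ) ≡ combo M τ ⊕ combo M σ
combo-⊕ []      []          []          = sym (⊕-self zeroV)
combo-⊕ (r ∷ M) (false ∷ τ) (false ∷ σ) = combo-⊕ M τ σ
combo-⊕ (r ∷ M) (true ∷ τ)  (false ∷ σ) = trans (cong (r ⊕_) (combo-⊕ M τ σ)) (sym (⊕-assoc r _ _))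
combo-⊕ (r ∷ M) (false ∷ τ) (true ∷ σ)  = begin
  r ⊕ combo M (τ ⊕ σ)            ≡⟨ cong (r ⊕_) (trans (combo-⊕ M τ σ) (⊕-comm _ _)) ⟩
  r ⊕ (combo M σ ⊕ combo M τ)    ≡⟨ sym (⊕-assoc r _ _) ⟩
  (r ⊕ combo M σ) ⊕ combo M τ    ≡⟨ ⊕-comm _ _ ⟩
  combo M τ ⊕ (r ⊕ combo M σ)    ∎
  where open ≡-Reasoning
combo-⊕ (r ∷ M) (true ∷ τ)  (true ∷ σ)  = begin
  combo M (τ ⊕ σ)                      ≡⟨ combo-⊕ M τ σ ⟩
  combo M τ ⊕ combo M σ                ≡⟨ sym (⊕-identityˡ _) ⟩
  zeroV ⊕ (combo M τ ⊕ combo M σ)      ≡⟨ cong (_⊕ _) (sym (⊕-self r)) ⟩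
  (r ⊕ r) ⊕ (combo M τ ⊕ combo M σ)    ≡⟨ ⊕-interchange r r _ _ ⟩
  (r ⊕ combo M τ) ⊕ (r ⊕ combo M σ)    ∎
  where open ≡-Reasoning

dot-combo : (M : Mat m n) (τ : Vec Bool m) (y : Vec Bool n) → dot (combo M τ) y ≡ dot τ (M · y)
dot-combo []      []          y = dot-zeroˡ y
dot-combo (r ∷ M) (false ∷ τ) y = dot-combo M τ y
dot-combo (r ∷ M) (true ∷ τ)  y = trans (dot-⊕ˡ r (combo M τ) y) (cong (dot r y xor_) (dot-combo M τ y))

cubeFold : (A → A → A) → (n : ℕ) → (Vec Bool n → A) → A
cubeFold _∙_ zero    f = f []
cubeFold _∙_ (suc n) f = cubeFold _∙_ n (λ v → f (false ∷ v) ∙ f (true ∷ v))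

cubeFold-cong : ∀ {_∙_ : A → A → A} n {f g : Vec Bool n → A} →
                (∀ v → f v ≡ g v) → cubeFold _∙_ n f ≡ cubeFold _∙_ n g
cubeFold-cong zero    f≗g = f≗g []
cubeFold-cong {_∙_ = _∙_} (suc n) f≗g = cubeFold-cong n (λ v → cong₂ _∙_ (f≗g (false ∷ v)) (f≗g (true ∷ v)))

cubeFold-homo : ∀ {_∙_ : A → A → A} {_∘′_ : B → B → B} (h : A → B) →
                (∀ x y → h (x ∙ y) ≡ h x ∘′ h y) →
                ∀ n (f : Vec Bool n → A) → h (cubeFold _∙_ n f) ≡ cubeFold _∘′_ n (h ∘ f)
cubeFold-homo h homo zero    f = refl
cubeFold-homo h homo (suc n) f =
  trans (cubeFold-homo h homo n _) (cubeFold-cong n (λ v → homo (f (false ∷ v)) (f (true ∷ v))))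


foldr-homo : ∀ {_∙_ : A → A → A} {_∘′_ : B → B → B} {ε ε′} (h : A → B) → h ε ≡ ε′ →
             (∀ x y → h (x ∙ y) ≡ h x ∘′ h y) → ∀ xs → h (foldr _∙_ ε xs) ≡ foldr _∘′_ ε′ (map h xs)
foldr-homo h h-ε h-∙ []       = h-ε
foldr-homo {_∘′_ = _∘′_} h h-ε h-∙ (x ∷ xs) = trans (h-∙ x _) (cong (h x ∘′_) (foldr-homo h h-ε h-∙ xs))

∈-allBits : (v : Vec Bool n) → v ∈ allBits n
∈-allBits []          = here refl
∈-allBits (false ∷ v) = ∈-concatMap⁺ _ (Any.map (λ { refl → here refl }) (∈-allBits v))
∈-allBits (true ∷ v)  = ∈-concatMap⁺ _ (Any.map (λ { refl → there (here refl) }) (∈-allBits v))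

module Sums {_∙_ : A → A → A} {ε : A} (isCM : IsCommutativeMonoid _≡_ _∙_ ε) where

  open IsCommutativeMonoid isCM using (assoc; comm; identityˡ; identityʳ; isCommutativeSemigroup)

  private
    semigroup : CommutativeSemigroup 0ℓ 0ℓ
    semigroup = record { isCommutativeSemigroup = isCommutativeSemigroup }

  open import Algebra.Properties.CommutativeSemigroup semigroup using (interchange)

  ∑ : (n : ℕ) → (Vec Bool n → A) → A
  ∑ = cubeFold _∙_

  ∑-distrib : ∀ n (f g : Vec Bool n → A) → ∑ n (λ v → f v ∙ g v) ≡ ∑ n f ∙ ∑ n g
  ∑-distrib zero    f g = refl
  ∑-distrib (suc n) f g =
    trans (cubeFold-cong n (λ v → interchange (f (false ∷ v)) (g (false ∷ v)) (f (true ∷ v)) (g (true ∷ v))))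
          (∑-distrib n _ _)

  ∑-comm : ∀ m n (f : Vec Bool m → Vec Bool n → A) →
           ∑ m (λ u → ∑ n (f u)) ≡ ∑ n (λ v → ∑ m (λ u → f u v))
  ∑-comm zero    n f = refl
  ∑-comm (suc m) n f = trans (cubeFold-cong m (λ u → sym (∑-distrib n _ _))) (∑-comm m n _)

  ∑-ε : ∀ n → ∑ n (λ _ → ε) ≡ ε
  ∑-ε zero    = refl
  ∑-ε (suc n) = trans (cubeFold-cong n (λ _ → identityˡ ε)) (∑-ε n)

  ∑-translate : ∀ n (f : Vec Bool n → A) w → ∑ n (λ v → f (v ⊕ w)) ≡ ∑ n f
  ∑-translate zero    f []          = refl
  ∑-translate (suc n) f (false ∷ w) = ∑-translate n _ w
  ∑-translate (suc n) f (true ∷ w)  = trans (cubeFold-cong n (λ _ → comm _ _)) (∑-translate n _ w)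

  sum : List A → A
  sum = foldr _∙_ ε

  sum-++ : ∀ xs ys → sum (xs ++ ys) ≡ sum xs ∙ sum ys
  sum-++ []       ys = sym (identityˡ _)
  sum-++ (x ∷ xs) ys = trans (cong (x ∙_) (sum-++ xs ys)) (sym (assoc x _ _))

  sum-map-ε : ∀ (xs : List B) → sum (map (λ _ → ε) xs) ≡ ε
  sum-map-ε []       = refl
  sum-map-ε (x ∷ xs) = trans (cong (ε ∙_) (sum-map-ε xs)) (identityˡ ε)

  sum-map-distrib : ∀ (f g : B → A) xs → sum (map (λ x → f x ∙ g x) xs) ≡ sum (map f xs) ∙ sum (map g xs)
  sum-map-distrib f g []       = sym (identityˡ ε)
  sum-map-distrib f g (x ∷ xs) = trans (cong (_ ∙_) (sum-map-distrib f g xs)) (interchange _ _ _ _)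

  sum-map-concatMap : ∀ (φ : B → A) (F : C → List B) xs →
                      sum (map φ (concatMap F xs)) ≡ sum (map (λ x → sum (map φ (F x))) xs)
  sum-map-concatMap φ F []       = refl
  sum-map-concatMap φ F (x ∷ xs) = begin
    sum (map φ (F x ++ concatMap F xs))                ≡⟨ cong sum (List.map-++ φ (F x) _) ⟩
    sum (map φ (F x) ++ map φ (concatMap F xs))        ≡⟨ sum-++ (map φ (F x)) _ ⟩
    sum (map φ (F x)) ∙ sum (map φ (concatMap F xs))   ≡⟨ cong (_ ∙_) (sum-map-concatMap φ F xs) ⟩
    sum (map φ (F x)) ∙ sum (map (λ x → sum (map φ (F x))) xs) ∎
    where open ≡-Reasoning

  sum-allBits : ∀ n (f : Vec Bool n → A) → sum (map f (allBits n)) ≡ ∑ n f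
  sum-allBits zero    f = identityʳ (f [])
  sum-allBits (suc n) f = trans (pairs (allBits n)) (sum-allBits n _)
    where
    pairs : ∀ vs → sum (map f (concatMap (λ v → (false ∷ v) ∷ (true ∷ v) ∷ []) vs))
                   ≡ sum (map (λ v → f (false ∷ v) ∙ f (true ∷ v)) vs)
    pairs []       = refl
    pairs (v ∷ vs) = trans (sym (assoc _ _ _)) (cong (_ ∙_) (pairs vs))

  ∑³ : (n : ℕ) → (Vec Bool n → Vec Bool n → Vec Bool n → A) → A
  ∑³ n f = ∑ n (λ a → ∑ n (λ b → ∑ n (λ c → f a b c)))

  sum-allBits³ : ∀ n (φ : B → A) (h : Vec Bool n → Vec Bool n → Vec Bool n → B) →
    sum (map φ (concatMap (λ a → concatMap (λ b → map (h a b) (allBits n)) (allBits n)) (allBits n)))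
    ≡ ∑³ n (λ a b c → φ (h a b c))
  sum-allBits³ n φ h =
    trans (sum-map-concatMap φ _ (allBits n)) (trans (sum-allBits n _) (cubeFold-cong n (λ a →
    trans (sum-map-concatMap φ _ (allBits n)) (trans (sum-allBits n _) (cubeFold-cong n (λ b →
    trans (cong sum (sym (List.map-∘ (allBits n)))) (sum-allBits n _)))))))

open Sums +-0-isCommutativeMonoid
module ℤ∑ = Sums ℤ.+-0-isCommutativeMonoid
module ℚ∑ = Sums ℚ.+-0-isCommutativeMonoid

𝟙 : Bool → ℕ
𝟙 b = if b then 1 else 0

δ₀ : Vec Bool n → ℕ
δ₀ v = 𝟙 (isZeroV v)

-- E t p is definitionally χ (coefT⁻¹ t p).
χ : Bool → ℤ.ℤ
χ b = if b then ℤ.- (+ 1) else + 1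

χ-cancel : ∀ b → χ b ℤ.+ χ (not b) ≡ + 0
χ-cancel true  = refl
χ-cancel false = refl

double-2^ : ∀ x → 2 ^ x + 2 ^ x ≡ 2 ^ suc x
double-2^ x = cong (λ y → 2 ^ x + y) (sym (+-identityʳ (2 ^ x)))

∑-χ-dot : ∀ m (w : Vec Bool m) → ℤ∑.∑ m (λ τ → χ (dot τ w)) ≡ + (2 ^ m * δ₀ w)
∑-χ-dot zero    []          = refl
∑-χ-dot (suc m) (false ∷ w) = begin
  ℤ∑.∑ m (λ τ → χ (dot τ w) ℤ.+ χ (dot τ w))                ≡⟨ ℤ∑.∑-distrib m _ _ ⟩
  ℤ∑.∑ m (λ τ → χ (dot τ w)) ℤ.+ ℤ∑.∑ m (λ τ → χ (dot τ w)) ≡⟨ cong₂ ℤ._+_ (∑-χ-dot m w) (∑-χ-dot m w) ⟩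
  + (2 ^ m * δ₀ w) ℤ.+ + (2 ^ m * δ₀ w)                      ≡⟨ sym (ℤ.pos-+ (2 ^ m * δ₀ w) _) ⟩
  + (2 ^ m * δ₀ w + 2 ^ m * δ₀ w)                            ≡⟨ cong +_ (sym (*-distribʳ-+ (δ₀ w) (2 ^ m) _)) ⟩
  + ((2 ^ m + 2 ^ m) * δ₀ w)                                 ≡⟨ cong (λ x → + (x * δ₀ w)) (double-2^ m) ⟩
  + (2 ^ suc m * δ₀ w)                                       ∎
  where open ≡-Reasoning
∑-χ-dot (suc m) (true ∷ w)  =
  trans (cubeFold-cong m (λ τ → χ-cancel (dot τ w)))
        (trans (ℤ∑.∑-ε m) (cong +_ (sym (*-zeroʳ (2 ^ suc m)))))

#ker : Mat m n → ℕ
#ker {n = n} M = ∑ n (λ y → δ₀ (M · y))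

#leftKer : Mat m n → ℕ
#leftKer {m = m} M = ∑ m (λ τ → δ₀ (combo M τ))

∑-scale : ∀ n c (f : Vec Bool n → ℕ) → ∑ n (λ v → c * f v) ≡ c * ∑ n f
∑-scale n c f = sym (cubeFold-homo (c *_) (*-distribˡ-+ c) n f)

∑-pos : ∀ n (f : Vec Bool n → ℕ) → ℤ∑.∑ n (λ v → + f v) ≡ + ∑ n f
∑-pos n f = sym (cubeFold-homo +_ ℤ.pos-+ n f)

-- Both sides evaluate Σ_y Σ_τ χ(τ · M y): summing over τ first, or over y first.
#ker-duality : (M : Mat m n) → 2 ^ m * #ker M ≡ 2 ^ n * #leftKer M
#ker-duality {m} {n} M = ℤ.+-injective (begin
  + (2 ^ m * #ker M)                                  ≡⟨ cong +_ (sym (∑-scale n (2 ^ m) _)) ⟩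
  + ∑ n (λ y → 2 ^ m * δ₀ (M · y))                    ≡⟨ sym (∑-pos n _) ⟩
  ℤ∑.∑ n (λ y → + (2 ^ m * δ₀ (M · y)))               ≡⟨ cubeFold-cong n (λ y → sym (∑-χ-dot m (M · y))) ⟩
  ℤ∑.∑ n (λ y → ℤ∑.∑ m (λ τ → χ (dot τ (M · y))))     ≡⟨ cubeFold-cong n (λ y → cubeFold-cong m (λ τ → cong χ (adjoint τ y))) ⟩
  ℤ∑.∑ n (λ y → ℤ∑.∑ m (λ τ → χ (dot y (combo M τ)))) ≡⟨ ℤ∑.∑-comm n m _ ⟩
  ℤ∑.∑ m (λ τ → ℤ∑.∑ n (λ y → χ (dot y (combo M τ)))) ≡⟨ cubeFold-cong m (λ τ → ∑-χ-dot n (combo M τ)) ⟩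
  ℤ∑.∑ m (λ τ → + (2 ^ n * δ₀ (combo M τ)))           ≡⟨ ∑-pos m _ ⟩
  + ∑ m (λ τ → 2 ^ n * δ₀ (combo M τ))                ≡⟨ cong +_ (∑-scale m (2 ^ n) _) ⟩
  + (2 ^ n * #leftKer M)                              ∎)
  where
  open ≡-Reasoning
  adjoint : ∀ τ y → dot τ (M · y) ≡ dot y (combo M τ)
  adjoint τ y = trans (sym (dot-combo M τ y)) (dot-comm (combo M τ) y)

_∈Span_ : Vec Bool n → Mat m n → Set
v ∈Span M = ∃ λ τ → combo M τ ≡ v

∃? : ∀ n {P : Pred (Vec Bool n) 0ℓ} → Decidable P → Dec (∃ P)
∃? zero        P? = map′ ([] ,_) (λ { ([] , p) → p }) (P? [])
∃? (suc n) {P} P? = map′ from to (∃? n (λ v → P? (false ∷ v) ⊎-dec P? (true ∷ v)))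
  where
  from : ∃ (λ v → P (false ∷ v) ⊎ P (true ∷ v)) → ∃ P
  from (v , inj₁ p) = false ∷ v , p
  from (v , inj₂ p) = true ∷ v , p
  to : ∃ P → ∃ (λ v → P (false ∷ v) ⊎ P (true ∷ v))
  to (false ∷ v , p) = v , inj₁ p
  to (true ∷ v , p)  = v , inj₂ p

_∈Span?_ : (v : Vec Bool n) (M : Mat m n) → Dec (v ∈Span M)
v ∈Span? M = ∃? _ (λ τ → Vec.≡-dec 𝔹._≟_ (combo M τ) v)

pivots : Mat m n → Vec Bool m
pivots []      = []
pivots (r ∷ M) = isNo (r ∈Span? M) ∷ pivots M

#pivots : Mat m n → ℕ
#pivots M = count (pivots M)

count≤length : (σ : Vec Bool m) → count σ ≤ m
count≤length []          = z≤n
count≤length (true ∷ σ)  = s≤s (count≤length σ)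
count≤length (false ∷ σ) = m≤n⇒m≤1+n (count≤length σ)

#pivots≤rows : (M : Mat m n) → #pivots M ≤ m
#pivots≤rows M = count≤length (pivots M)

-- A row in the span of the rows below it doubles the left kernel (translate by a τ₀ representing it);
-- any other row leaves it unchanged.
#leftKer-pivots : (M : Mat m n) → #leftKer M ≡ 2 ^ (m ∸ #pivots M)
#leftKer-pivots {n = n} []      = cong 𝟙 (isZeroV-zeroV n)
#leftKer-pivots {suc m} (r ∷ M) with r ∈Span? M
... | yes (τ₀ , τ₀↦r) = begin
  ∑ m (λ τ → δ₀ (combo M τ) + δ₀ (r ⊕ combo M τ))       ≡⟨ ∑-distrib m _ _ ⟩
  #leftKer M + ∑ m (λ τ → δ₀ (r ⊕ combo M τ))          ≡⟨ cong (_+_ (#leftKer M)) (sym (∑-translate m _ τ₀)) ⟩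
  #leftKer M + ∑ m (λ τ → δ₀ (r ⊕ combo M (τ ⊕ τ₀)))   ≡⟨ cong (_+_ (#leftKer M)) (cubeFold-cong m (cong δ₀ ∘ shifted)) ⟩
  #leftKer M + #leftKer M                               ≡⟨ cong (λ x → x + x) (#leftKer-pivots M) ⟩
  2 ^ (m ∸ #pivots M) + 2 ^ (m ∸ #pivots M)             ≡⟨ double-2^ (m ∸ #pivots M) ⟩
  2 ^ suc (m ∸ #pivots M)                               ≡⟨ cong (2 ^_) (sym (+-∸-assoc 1 (#pivots≤rows M))) ⟩
  2 ^ (suc m ∸ #pivots M)                               ∎
  where
  open ≡-Reasoning
  shifted : ∀ τ → r ⊕ combo M (τ ⊕ τ₀) ≡ combo M τ
  shifted τ = begin
    r ⊕ combo M (τ ⊕ τ₀)        ≡⟨ cong (r ⊕_) (combo-⊕ M τ τ₀) ⟩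
    r ⊕ (combo M τ ⊕ combo M τ₀) ≡⟨ cong (λ x → r ⊕ (combo M τ ⊕ x)) τ₀↦r ⟩
    r ⊕ (combo M τ ⊕ r)          ≡⟨ cong (r ⊕_) (⊕-comm _ r) ⟩
    r ⊕ (r ⊕ combo M τ)          ≡⟨ ⊕-cancelˡ r _ ⟩
    combo M τ                    ∎
... | no r∉M = begin
  ∑ m (λ τ → δ₀ (combo M τ) + δ₀ (r ⊕ combo M τ))   ≡⟨ ∑-distrib m _ _ ⟩
  #leftKer M + ∑ m (λ τ → δ₀ (r ⊕ combo M τ))      ≡⟨ cong (_+_ (#leftKer M)) (trans (cubeFold-cong m vanishes) (∑-ε m)) ⟩
  #leftKer M + 0                                    ≡⟨ +-identityʳ _ ⟩
  #leftKer M                                        ≡⟨ #leftKer-pivots M ⟩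
  2 ^ (m ∸ #pivots M)                               ∎
  where
  open ≡-Reasoning
  vanishes : ∀ τ → δ₀ (r ⊕ combo M τ) ≡ 0
  vanishes τ with isZeroV (r ⊕ combo M τ) in zero?
  ... | false = refl
  ... | true  = ⊥-elim (r∉M (τ , sym (isZeroV-⊕⇒≡ r _ zero?)))

2^-reflects-≤ : ∀ {a b} → 2 ^ a ≤ 2 ^ b → a ≤ b
2^-reflects-≤ {a} {b} 2^a≤2^b with a ≤? b
... | yes a≤b = a≤b
... | no  a≰b = ⊥-elim (<⇒≱ (^-monoʳ-< 2 (s≤s (s≤s z≤n)) (≰⇒> a≰b)) 2^a≤2^b)

2^-injective : ∀ {a b} → 2 ^ a ≡ 2 ^ b → a ≡ b
2^-injective eq = ≤-antisym (2^-reflects-≤ (≤-reflexive eq)) (2^-reflects-≤ (≤-reflexive (sym eq)))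

term≤∑ : ∀ n (f : Vec Bool n → ℕ) v → f v ≤ ∑ n f
term≤∑ zero    f []          = ≤-refl
term≤∑ (suc n) f (false ∷ v) = ≤-trans (m≤m+n _ _) (term≤∑ n _ v)
term≤∑ (suc n) f (true ∷ v)  = ≤-trans (m≤n+m _ _) (term≤∑ n _ v)

∑-mono-≤ : ∀ n {f g : Vec Bool n → ℕ} → (∀ v → f v ≤ g v) → ∑ n f ≤ ∑ n g
∑-mono-≤ zero    f≤g = f≤g []
∑-mono-≤ (suc n) f≤g = ∑-mono-≤ n (λ v → +-mono-≤ (f≤g (false ∷ v)) (f≤g (true ∷ v)))

·-zeroʳ : (M : Mat m n) → M · zeroV ≡ zeroV
·-zeroʳ []      = refl
·-zeroʳ (r ∷ M) = cong₂ _∷_ (trans (dot-comm r zeroV) (dot-zeroˡ r)) (·-zeroʳ M)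

#ker-scaled : (M : Mat m n) → 2 ^ m * #ker M ≡ 2 ^ (n + (m ∸ #pivots M))
#ker-scaled {m} {n} M = begin
  2 ^ m * #ker M               ≡⟨ #ker-duality M ⟩
  2 ^ n * #leftKer M           ≡⟨ cong (2 ^ n *_) (#leftKer-pivots M) ⟩
  2 ^ n * 2 ^ (m ∸ #pivots M)  ≡⟨ sym (^-distribˡ-+-* 2 n _) ⟩
  2 ^ (n + (m ∸ #pivots M))    ∎
  where open ≡-Reasoning

#pivots≤cols : (M : Mat m n) → #pivots M ≤ n
#pivots≤cols {m} {n} M = +-cancelʳ-≤ (m ∸ #pivots M) (#pivots M) n (begin
  #pivots M + (m ∸ #pivots M)  ≡⟨ m+[n∸m]≡n (#pivots≤rows M) ⟩
  m                            ≤⟨ 2^-reflects-≤ 2^m≤ ⟩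
  n + (m ∸ #pivots M)          ∎)
  where
  open ≤-Reasoning
  0∈ker : 1 ≤ #ker M
  0∈ker = subst (_≤ #ker M) (trans (cong δ₀ (·-zeroʳ M)) (cong 𝟙 (isZeroV-zeroV m))) (term≤∑ n _ zeroV)
  2^m≤ : 2 ^ m ≤ 2 ^ (n + (m ∸ #pivots M))
  2^m≤ = subst₂ _≤_ (*-identityʳ (2 ^ m)) (#ker-scaled M) (*-monoʳ-≤ (2 ^ m) 0∈ker)

#ker-pivots : (M : Mat m n) → #ker M ≡ 2 ^ (n ∸ #pivots M)
#ker-pivots {m} {n} M = *-cancelˡ-≡ _ _ (2 ^ m) {{m^n≢0 2 m}} (begin
  2 ^ m * #ker M                     ≡⟨ #ker-scaled M ⟩
  2 ^ (n + (m ∸ p))                  ≡⟨ cong (2 ^_) exchange ⟩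
  2 ^ (m + (n ∸ p))                  ≡⟨ ^-distribˡ-+-* 2 m (n ∸ p) ⟩
  2 ^ m * 2 ^ (n ∸ p)                ∎)
  where
  open ≡-Reasoning
  p = #pivots M
  exchange : n + (m ∸ p) ≡ m + (n ∸ p)
  exchange = trans (sym (+-∸-assoc n (#pivots≤rows M)))
               (trans (cong (_∸ p) (+-comm n m)) (+-∸-assoc m (#pivots≤cols M)))

mask : Mat m n → Vec Bool m → Mat m n
mask []      []      = []
mask (r ∷ M) (b ∷ σ) = (if b then r else zeroV) ∷ mask M σ

mask-preserves-ker : (M : Mat m n) (σ : Vec Bool m) (y : Vec Bool n) →
                     isZeroV (M · y) ≡ true → isZeroV (mask M σ · y) ≡ true
mask-preserves-ker []      []      y _  = refl
mask-preserves-ker (r ∷ M) (true ∷ σ)  y My≡0 with dot r y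
... | false = mask-preserves-ker M σ y My≡0
mask-preserves-ker (r ∷ M) (false ∷ σ) y My≡0 with dot r y
... | false rewrite dot-zeroˡ y = mask-preserves-ker M σ y My≡0

𝟙-mono : ∀ {a b} → (a ≡ true → b ≡ true) → 𝟙 a ≤ 𝟙 b
𝟙-mono {true}  a⇒b rewrite a⇒b refl = ≤-refl
𝟙-mono {false} a⇒b = z≤n

#pivots-mask≤ : (M : Mat m n) (σ : Vec Bool m) → #pivots (mask M σ) ≤ #pivots M
#pivots-mask≤ {n = n} M σ = ∸-cancelʳ-≤ (#pivots≤cols (mask M σ)) (2^-reflects-≤ (subst₂ _≤_
  (#ker-pivots M) (#ker-pivots (mask M σ))
  (∑-mono-≤ n (λ y → 𝟙-mono (mask-preserves-ker M σ y)))))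

combo-mask : (M : Mat m n) (σ τ : Vec Bool m) → combo (mask M σ) τ ≡ combo M (τ ∩ σ)
combo-mask []      []          []          = refl
combo-mask (r ∷ M) (true ∷ σ)  (true ∷ τ)  = cong (r ⊕_) (combo-mask M σ τ)
combo-mask (r ∷ M) (false ∷ σ) (true ∷ τ)  = trans (⊕-identityˡ _) (combo-mask M σ τ)
combo-mask (r ∷ M) (_ ∷ σ)     (false ∷ τ) = combo-mask M σ τ

allL-∈ : ∀ (p : A → Bool) {x} xs → allL p xs ≡ true → x ∈ xs → p x ≡ true
allL-∈ p (y ∷ ys) all (here refl) with p y
... | true = refl
allL-∈ p (y ∷ ys) all (there x∈) with p y
... | true = allL-∈ p ys all x∈

allL-intro : ∀ (p : A → Bool) xs → (∀ x → p x ≡ true) → allL p xs ≡ true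
allL-intro p []       _   = refl
allL-intro p (x ∷ xs) all rewrite all x = allL-intro p xs all

independent-elim : (M : Mat m n) (σ τ : Vec Bool m) → independent M σ ≡ true →
                   subsel τ σ ≡ true → nonempty τ ≡ true → isZeroV (combo M τ) ≡ false
independent-elim {m} M σ τ indep τ⊆σ τ≢0 =
  implication (allL-∈ _ (allBits m) indep (∈-allBits τ)) τ⊆σ τ≢0
  where
  implication : ∀ {a b c} → not (a ∧ b) ∨ not c ≡ true → a ≡ true → b ≡ true → c ≡ false
  implication {true} {true} {false} _ _ _ = refl

independent-intro : (M : Mat m n) (σ : Vec Bool m) →
                    (∀ τ → subsel τ σ ≡ true → nonempty τ ≡ true → isZeroV (combo M τ) ≡ false) →
                    independent M σ ≡ true
independent-intro {m} M σ indep = allL-intro _ (allBits m) (λ τ → implication (indep τ))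
  where
  implication : ∀ {a b c} → (a ≡ true → b ≡ true → c ≡ false) → not (a ∧ b) ∨ not c ≡ true
  implication {true}  {true}  a∧b⇒¬c rewrite a∧b⇒¬c refl refl = refl
  implication {true}  {false} _ = refl
  implication {false}         _ = refl

∑-δ₀-∩ : (σ : Vec Bool m) → ∑ m (λ τ → δ₀ (τ ∩ σ)) ≡ 2 ^ (m ∸ count σ)
∑-δ₀-∩ []                = refl
∑-δ₀-∩ {suc m} (true ∷ σ)  = trans (cubeFold-cong m (λ τ → +-identityʳ _)) (∑-δ₀-∩ σ)
∑-δ₀-∩ {suc m} (false ∷ σ) = begin
  ∑ m (λ τ → δ₀ (τ ∩ σ) + δ₀ (τ ∩ σ))      ≡⟨ ∑-distrib m _ _ ⟩
  ∑ m (λ τ → δ₀ (τ ∩ σ)) + ∑ m (λ τ → δ₀ (τ ∩ σ)) ≡⟨ cong (λ x → x + x) (∑-δ₀-∩ σ) ⟩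
  2 ^ (m ∸ count σ) + 2 ^ (m ∸ count σ)    ≡⟨ double-2^ (m ∸ count σ) ⟩
  2 ^ suc (m ∸ count σ)                    ≡⟨ cong (2 ^_) (sym (+-∸-assoc 1 (count≤length σ))) ⟩
  2 ^ (suc m ∸ count σ)                    ∎
  where open ≡-Reasoning

subsel-∩ : (τ σ : Vec Bool m) → subsel (τ ∩ σ) σ ≡ true
subsel-∩ []          []          = refl
subsel-∩ (true ∷ τ)  (true ∷ σ)  = subsel-∩ τ σ
subsel-∩ (true ∷ τ)  (false ∷ σ) = subsel-∩ τ σ
subsel-∩ (false ∷ τ) (_ ∷ σ)     = subsel-∩ τ σ

nonempty≡not-isZeroV : (v : Vec Bool m) → nonempty v ≡ not (isZeroV v)
nonempty≡not-isZeroV []          = refl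
nonempty≡not-isZeroV (true ∷ v)  = refl
nonempty≡not-isZeroV (false ∷ v) = nonempty≡not-isZeroV v

isZeroV-combo-independent : (M : Mat m n) (σ τ : Vec Bool m) → independent M σ ≡ true →
                            subsel τ σ ≡ true → isZeroV (combo M τ) ≡ isZeroV τ
isZeroV-combo-independent {n = n} M σ τ indep τ⊆σ with isZeroV τ in τ≡0?
... | true  = trans (cong (isZeroV ∘ combo M) (isZeroV⇒≡zeroV τ τ≡0?))
                    (trans (cong isZeroV (combo-zero M)) (isZeroV-zeroV n))
... | false = independent-elim M σ τ indep τ⊆σ (trans (nonempty≡not-isZeroV τ) (cong not τ≡0?))

#leftKer-mask : (M : Mat m n) (σ : Vec Bool m) → independent M σ ≡ true →
                #leftKer (mask M σ) ≡ 2 ^ (m ∸ count σ)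
#leftKer-mask {m} M σ indep = begin
  ∑ m (λ τ → δ₀ (combo (mask M σ) τ))   ≡⟨ cubeFold-cong m (cong δ₀ ∘ combo-mask M σ) ⟩
  ∑ m (λ τ → δ₀ (combo M (τ ∩ σ)))      ≡⟨ cubeFold-cong m (cong 𝟙 ∘ injective) ⟩
  ∑ m (λ τ → δ₀ (τ ∩ σ))                ≡⟨ ∑-δ₀-∩ σ ⟩
  2 ^ (m ∸ count σ)                     ∎
  where
  open ≡-Reasoning
  injective : ∀ τ → isZeroV (combo M (τ ∩ σ)) ≡ isZeroV (τ ∩ σ)
  injective τ = isZeroV-combo-independent M σ (τ ∩ σ) indep (subsel-∩ τ σ)

#pivots-mask : (M : Mat m n) (σ : Vec Bool m) → independent M σ ≡ true → #pivots (mask M σ) ≡ count σ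
#pivots-mask M σ indep = ∸-cancelˡ-≡ (#pivots≤rows (mask M σ)) (count≤length σ)
  (2^-injective (trans (sym (#leftKer-pivots (mask M σ))) (#leftKer-mask M σ indep)))

pivots-independent : (M : Mat m n) → independent M (pivots M) ≡ true
pivots-independent M = independent-intro M (pivots M) (nonzero M)
  where
  nonzero : ∀ {m} (M : Mat m n) τ → subsel τ (pivots M) ≡ true → nonempty τ ≡ true →
            isZeroV (combo M τ) ≡ false
  nonzero (r ∷ M) (false ∷ τ) τ⊆p τ≢0 = nonzero M τ τ⊆p τ≢0
  nonzero (r ∷ M) (true ∷ τ)  τ⊆p τ≢0 with r ∈Span? M | isZeroV (r ⊕ combo M τ) in r+Mτ≡0?
  ... | no r∉M | false = refl
  ... | no r∉M | true  = ⊥-elim (r∉M (τ , sym (isZeroV-⊕⇒≡ r _ r+Mτ≡0?)))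

foldr-⊔-lub : ∀ (f : A → ℕ) xs {b} → (∀ x → f x ≤ b) → foldr _⊔_ 0 (map f xs) ≤ b
foldr-⊔-lub f []       f≤b = z≤n
foldr-⊔-lub f (x ∷ xs) f≤b = ⊔-lub (f≤b x) (foldr-⊔-lub f xs f≤b)

foldr-⊔-upper : ∀ (f : A → ℕ) {x} xs → x ∈ xs → f x ≤ foldr _⊔_ 0 (map f xs)
foldr-⊔-upper f (y ∷ ys) (here refl) = m≤m⊔n _ _
foldr-⊔-upper f (y ∷ ys) (there x∈)  = ≤-trans (foldr-⊔-upper f ys x∈) (m≤n⊔m _ _)

rank≡#pivots : (M : Mat m n) → rank M ≡ #pivots M
rank≡#pivots {m} M =
  ≤-antisym (foldr-⊔-lub size (allBits m) size≤#pivots)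
            (subst (_≤ rank M) size-pivots (foldr-⊔-upper size (allBits m) (∈-allBits (pivots M))))
  where
  size : Vec Bool m → ℕ
  size σ = if independent M σ then count σ else 0
  size≤#pivots : ∀ σ → size σ ≤ #pivots M
  size≤#pivots σ with independent M σ in indep
  ... | true  = subst (_≤ #pivots M) (#pivots-mask M σ indep) (#pivots-mask≤ M σ)
  ... | false = z≤n
  size-pivots : size (pivots M) ≡ #pivots M
  size-pivots rewrite pivots-independent M = refl

rank≤rows : (M : Mat m n) → rank M ≤ m
rank≤rows M = subst (_≤ _) (sym (rank≡#pivots M)) (#pivots≤rows M)

rank≤cols : (M : Mat m n) → rank M ≤ n
rank≤cols M = subst (_≤ _) (sym (rank≡#pivots M)) (#pivots≤cols M)

#ker-rank : (M : Mat m n) → #ker M ≡ 2 ^ (n ∸ rank M)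
#ker-rank {n = n} M = trans (#ker-pivots M) (cong (λ r → 2 ^ (n ∸ r)) (sym (rank≡#pivots M)))

shift : 𝕡 → 𝕡
shift t i = t (suc i)

coef-addP : ∀ t p q → coefT⁻¹ t (addP p q) ≡ coefT⁻¹ t p xor coefT⁻¹ t q
coef-addP t []      q       = refl
coef-addP t (a ∷ p) []      = sym (xor-identityʳ _)
coef-addP t (a ∷ p) (b ∷ q) =
  trans (cong ((a xor b) ∧ t 0 xor_) (coef-addP (shift t) p q)) (xor-∧-interchange a b (t 0) _ _)

coef-scale : ∀ t a q → coefT⁻¹ t (map (a ∧_) q) ≡ a ∧ coefT⁻¹ t q
coef-scale t a []      = sym (𝔹.∧-zeroʳ a)
coef-scale t a (b ∷ q) =
  trans (cong ((a ∧ b) ∧ t 0 xor_) (coef-scale (shift t) a q)) (step a b (t 0) _)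
  where
  step : ∀ a b c x → (a ∧ b) ∧ c xor a ∧ x ≡ a ∧ (b ∧ c xor x)
  step = solve-∀ 𝔽₂

coef-mulP-∷ : ∀ t a p q → coefT⁻¹ t (mulP (a ∷ p) q) ≡ a ∧ coefT⁻¹ t q xor coefT⁻¹ (shift t) (mulP p q)
coef-mulP-∷ t a p q = trans (coef-addP t (map (a ∧_) q) (false ∷ mulP p q)) (cong (_xor _) (coef-scale t a q))

coef-toList : ∀ t (Z : Vec Bool n) → coefT⁻¹ t (Vec.toList Z) ≡ dot Z (Vec.tabulate (t ∘ toℕ))
coef-toList t []      = refl
coef-toList t (z ∷ Z) = cong (z ∧ t 0 xor_) (coef-toList (shift t) Z)

dot-tabulate-affine : (Z : Vec Bool n) (f h : Fin n → Bool) (y : Bool) →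
  dot Z (Vec.tabulate (λ i → f i ∧ y xor h i)) ≡ y ∧ dot Z (Vec.tabulate f) xor dot Z (Vec.tabulate h)
dot-tabulate-affine []      f h y = sym (trans (xor-identityʳ (y ∧ false)) (𝔹.∧-zeroʳ y))
dot-tabulate-affine (z ∷ Z) f h y =
  trans (cong (z ∧ (f zeroF ∧ y xor h zeroF) xor_) (dot-tabulate-affine Z _ _ y)) (step z (f zeroF) y (h zeroF) _ _)
  where
  step : ∀ z f y h A b → z ∧ (f ∧ y xor h) xor (y ∧ A xor b) ≡ y ∧ (z ∧ f xor A) xor (z ∧ h xor b)
  step = solve-∀ 𝔽₂

hankel-· : ∀ s k t (Y : Vec Bool k) →
           hankel s k t · Y ≡ Vec.tabulate (λ i → dot (Vec.tabulate (λ j → t (toℕ i + toℕ j))) Y)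
hankel-· s k t Y = sym (Vec.tabulate-∘ _ _)

dot-tabulate-false : (Z : Vec Bool n) → dot Z (Vec.tabulate (λ _ → false)) ≡ false
dot-tabulate-false []      = refl
dot-tabulate-false (z ∷ Z) = trans (cong (z ∧ false xor_) (dot-tabulate-false Z)) (step z)
  where
  step : ∀ z → z ∧ false xor false ≡ false
  step = solve-∀ 𝔽₂

hankel-row-∷ : ∀ t i y (Y : Vec Bool k) →
  dot (Vec.tabulate (λ j → t (i + toℕ j))) (y ∷ Y) ≡ t i ∧ y xor dot (Vec.tabulate (λ j → shift t (i + toℕ j))) Y
hankel-row-∷ t i y Y = cong₂ (λ a row → a ∧ y xor dot row Y)
  (cong t (+-identityʳ i)) (Vec.tabulate-cong (λ j → cong t (+-suc i (toℕ j))))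

coef-mulP : ∀ s k t (Y : Vec Bool k) (Z : Vec Bool s) →
            coefT⁻¹ t (mulP (Vec.toList Y) (Vec.toList Z)) ≡ dot Z (hankel s k t · Y)
coef-mulP s zero    t []      Z = sym (trans (cong (dot Z) (hankel-· s 0 t [])) (dot-tabulate-false Z))
coef-mulP s (suc k) t (y ∷ Y) Z = begin
  coefT⁻¹ t (mulP (y ∷ Vec.toList Y) (Vec.toList Z))
    ≡⟨ coef-mulP-∷ t y (Vec.toList Y) (Vec.toList Z) ⟩
  y ∧ coefT⁻¹ t (Vec.toList Z) xor coefT⁻¹ (shift t) (mulP (Vec.toList Y) (Vec.toList Z))
    ≡⟨ cong₂ (λ a b → y ∧ a xor b) (coef-toList t Z) (trans (coef-mulP s k (shift t) Y Z) (cong (dot Z) (hankel-· s k (shift t) Y))) ⟩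
  y ∧ dot Z (Vec.tabulate (t ∘ toℕ)) xor dot Z (Vec.tabulate (λ i → dot (Vec.tabulate (λ j → shift t (toℕ i + toℕ j))) Y))
    ≡⟨ sym (dot-tabulate-affine Z _ _ y) ⟩
  dot Z (Vec.tabulate (λ i → t (toℕ i) ∧ y xor dot (Vec.tabulate (λ j → shift t (toℕ i + toℕ j))) Y))
    ≡⟨ cong (dot Z) (Vec.tabulate-cong (λ i → sym (hankel-row-∷ t (toℕ i) y Y))) ⟩
  dot Z (Vec.tabulate (λ i → dot (Vec.tabulate (λ j → t (toℕ i + toℕ j))) (y ∷ Y)))
    ≡⟨ cong (dot Z) (sym (hankel-· s (suc k) t (y ∷ Y))) ⟩
  dot Z (hankel s (suc k) t · (y ∷ Y)) ∎
  where open ≡-Reasoning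

∑-E-hankel : ∀ s k t (Y : Vec Bool k) → Σpoly s (λ Z → E t (mulP (poly Y) Z)) ≡ + (2 ^ s * δ₀ (hankel s k t · Y))
∑-E-hankel s k t Y =
  trans (ℤ∑.sum-allBits s _) (trans (cubeFold-cong s (cong χ ∘ coef-mulP s k t Y)) (∑-χ-dot s _))

Σpoly-*ʳ : ∀ d (f : Poly → ℤ.ℤ) c → Σpoly d (λ p → f p ℤ.* c) ≡ Σpoly d f ℤ.* c
Σpoly-*ʳ d f c = begin
  Σpoly d (λ p → f p ℤ.* c)                  ≡⟨ ℤ∑.sum-allBits d _ ⟩
  ℤ∑.∑ d (λ v → f (poly v) ℤ.* c)            ≡⟨ sym (cubeFold-homo (ℤ._* c) (ℤ.*-distribʳ-+ c) d _) ⟩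
  ℤ∑.∑ d (λ v → f (poly v)) ℤ.* c            ≡⟨ cong (ℤ._* c) (sym (ℤ∑.sum-allBits d _)) ⟩
  Σpoly d f ℤ.* c                            ∎
  where open ≡-Reasoning

𝟙-∧ : ∀ a b → 𝟙 (a ∧ b) ≡ 𝟙 a * 𝟙 b
𝟙-∧ true  b = sym (+-identityʳ (𝟙 b))
𝟙-∧ false b = refl

δ₀-++ : (u : Vec Bool m) (v : Vec Bool n) → δ₀ (u Vec.++ v) ≡ δ₀ u * δ₀ v
δ₀-++ []          v = sym (+-identityʳ (δ₀ v))
δ₀-++ (true ∷ u)  v = refl
δ₀-++ (false ∷ u) v = δ₀-++ u v

δ₀-·-++ : (M : Mat m k) (N : Mat n k) (y : Vec Bool k) → δ₀ ((M Vec.++ N) · y) ≡ δ₀ (M · y) * δ₀ (N · y)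
δ₀-·-++ M N y = trans (cong δ₀ (·-++ M N y)) (δ₀-++ (M · y) (N · y))

δ₀-D : ∀ s k t η ξ (Y : Vec Bool k) →
  δ₀ (D s k t η ξ · Y) ≡ δ₀ (hankel s k t · Y) * δ₀ (hankel s k η · Y) * δ₀ (hankel s k ξ · Y)
δ₀-D s k t η ξ Y = trans (δ₀-·-++ (hankel s k t Vec.++ hankel s k η) (hankel s k ξ) Y)
                         (cong (_* δ₀ (hankel s k ξ · Y)) (δ₀-·-++ (hankel s k t) (hankel s k η) Y))

2^[3s] : ∀ s → 2 ^ (3 * s) ≡ 2 ^ s * (2 ^ s * (2 ^ s * 1))
2^[3s] s = trans (cong (2 ^_) (*-comm 3 s)) (sym (^-*-assoc 2 s 3))

g-#ker : ∀ k s t η ξ → g k s t η ξ ≡ + (2 ^ (3 * s) * #ker (D s k t η ξ))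
g-#ker k s t η ξ = begin
  g k s t η ξ
    ≡⟨ ℤ∑.sum-allBits k _ ⟩
  ℤ∑.∑ k (λ Y → Σpoly s λ Z → E t (mulP (poly Y) Z) ℤ.* (Σpoly s λ U → E η (mulP (poly Y) U) ℤ.* (Σpoly s λ V → E ξ (mulP (poly Y) V))))
    ≡⟨ cubeFold-cong k (λ Y → trans (Σpoly-*ʳ s (λ Z → E t (mulP (poly Y) Z)) _) (cong₂ ℤ._*_ (∑-E-hankel s k t Y)
         (trans (Σpoly-*ʳ s (λ U → E η (mulP (poly Y) U)) _) (cong₂ ℤ._*_ (∑-E-hankel s k η Y) (∑-E-hankel s k ξ Y))))) ⟩
  ℤ∑.∑ k (λ Y → + (x * a Y) ℤ.* (+ (x * b Y) ℤ.* + (x * c Y)))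
    ≡⟨ cubeFold-cong k (λ Y → trans (cong (+ (x * a Y) ℤ.*_) (sym (ℤ.pos-* (x * b Y) _))) (sym (ℤ.pos-* (x * a Y) _))) ⟩
  ℤ∑.∑ k (λ Y → + (x * a Y * (x * b Y * (x * c Y))))
    ≡⟨ ∑-pos k _ ⟩
  + ∑ k (λ Y → x * a Y * (x * b Y * (x * c Y)))
    ≡⟨ cong +_ (cubeFold-cong k (λ Y → trans (collect x (a Y) (b Y) (c Y))
         (cong₂ _*_ (sym (2^[3s] s)) (sym (δ₀-D s k t η ξ Y))))) ⟩
  + ∑ k (λ Y → 2 ^ (3 * s) * δ₀ (D s k t η ξ · Y))
    ≡⟨ cong +_ (∑-scale k (2 ^ (3 * s)) _) ⟩
  + (2 ^ (3 * s) * #ker (D s k t η ξ))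
    ∎
  where
  open ≡-Reasoning
  x = 2 ^ s
  a b c : Vec Bool k → ℕ
  a Y = δ₀ (hankel s k t · Y)
  b Y = δ₀ (hankel s k η · Y)
  c Y = δ₀ (hankel s k ξ · Y)
  collect : ∀ x a b c → x * a * (x * b * (x * c)) ≡ x * (x * (x * 1)) * (a * b * c)
  collect = solve-∀ ℕ-ring

g-rank : ∀ k s t η ξ → g k s t η ξ ≡ + (2 ^ (3 * s + k ∸ rank (D s k t η ξ)))
g-rank k s t η ξ = trans (g-#ker k s t η ξ) (cong +_ (begin
  2 ^ (3 * s) * #ker (D s k t η ξ)  ≡⟨ cong (2 ^ (3 * s) *_) (#ker-rank (D s k t η ξ)) ⟩
  2 ^ (3 * s) * 2 ^ (k ∸ r)         ≡⟨ sym (^-distribˡ-+-* 2 (3 * s) (k ∸ r)) ⟩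
  2 ^ (3 * s + (k ∸ r))             ≡⟨ cong (2 ^_) (sym (+-∸-assoc (3 * s) (rank≤cols (D s k t η ξ)))) ⟩
  2 ^ (3 * s + k ∸ r)               ∎))
  where
  open ≡-Reasoning
  r = rank (D s k t η ξ)

-- Once the denominator is visibly a successor, these rationals are literally in normal form.
ℕ→ℚ≡mkℚ : ∀ n → ℕ→ℚ n ≡ mkℚ (+ n) 0 (Coprime.sym (Coprime.1-coprimeTo n))
ℕ→ℚ≡mkℚ n = ℚ.↥p/↧p≡p _

2^-≡mkℚ : ∀ y m → 2 ^ y ≡ suc m → 2^- y ≡ mkℚ (+ 1) m (Coprime.1-coprimeTo (suc m))
2^-≡mkℚ y m 2^y≡1+m = trans (ℚ./-cong {+ 1} {2 ^ y} {+ 1} {suc m} {{m^n≢0 2 y}} refl 2^y≡1+m) (ℚ.↥p/↧p≡p _)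

2^≡suc : ∀ y → ∃ λ m → 2 ^ y ≡ suc m
2^≡suc y with 2 ^ y | m^n>0 2 y
... | suc m | _ = m , refl

ℕ→ℚ-+ : ∀ a b → ℕ→ℚ (a + b) ≡ ℕ→ℚ a ℚ.+ ℕ→ℚ b
ℕ→ℚ-+ a b = sym (trans (cong₂ ℚ._+_ (ℕ→ℚ≡mkℚ a) (ℕ→ℚ≡mkℚ b))
  (ℚ./-cong (trans (cong₂ ℤ._+_ (ℤ.*-identityʳ (+ a)) (ℤ.*-identityʳ (+ b))) (sym (ℤ.pos-+ a b))) refl))

ℕ→ℚ-* : ∀ a b → ℕ→ℚ (a * b) ≡ ℕ→ℚ a ℚ.* ℕ→ℚ b
ℕ→ℚ-* a b = sym (trans (cong₂ ℚ._*_ (ℕ→ℚ≡mkℚ a) (ℕ→ℚ≡mkℚ b)) (ℚ./-cong (sym (ℤ.pos-* a b)) refl))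

2^-‿distrib-+ : ∀ x y → 2^- (x + y) ≡ 2^- x ℚ.* 2^- y
2^-‿distrib-+ x y with 2^≡suc x | 2^≡suc y
... | a , 2^x≡1+a | b , 2^y≡1+b =
  trans (ℚ./-cong {+ 1} {2 ^ (x + y)} {+ 1 ℤ.* + 1} {suc a * suc b} {{m^n≢0 2 (x + y)}} refl
                  (trans (^-distribˡ-+-* 2 x y) (cong₂ _*_ 2^x≡1+a 2^y≡1+b)))
        (sym (cong₂ ℚ._*_ (2^-≡mkℚ x a 2^x≡1+a) (2^-≡mkℚ y b 2^y≡1+b)))

2^-inverse : ∀ y → ℕ→ℚ (2 ^ y) ℚ.* 2^- y ≡ ℚ.1ℚ
2^-inverse y with 2^≡suc y
... | m , 2^y≡1+m = trans (cong₂ ℚ._*_ (trans (cong ℕ→ℚ 2^y≡1+m) (ℕ→ℚ≡mkℚ (suc m))) (2^-≡mkℚ y m 2^y≡1+m))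
                          (ℚ.*-inverseʳ (mkℚ (+ suc m) 0 (Coprime.sym (Coprime.1-coprimeTo (suc m)))))

2^-‿cancel : ∀ x y T → 2^- (x + y) ℚ.* ℕ→ℚ (2 ^ y * T) ≡ 2^- x ℚ.* ℕ→ℚ T
2^-‿cancel x y T = begin
  2^- (x + y) ℚ.* ℕ→ℚ (2 ^ y * T)                    ≡⟨ cong₂ ℚ._*_ (2^-‿distrib-+ x y) (ℕ→ℚ-* (2 ^ y) T) ⟩
  (2^- x ℚ.* 2^- y) ℚ.* (ℕ→ℚ (2 ^ y) ℚ.* ℕ→ℚ T)      ≡⟨ ℚ.*-assoc (2^- x) _ _ ⟩
  2^- x ℚ.* (2^- y ℚ.* (ℕ→ℚ (2 ^ y) ℚ.* ℕ→ℚ T))      ≡⟨ cong (2^- x ℚ.*_) (sym (ℚ.*-assoc (2^- y) _ _)) ⟩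
  2^- x ℚ.* ((2^- y ℚ.* ℕ→ℚ (2 ^ y)) ℚ.* ℕ→ℚ T)      ≡⟨ cong (λ z → 2^- x ℚ.* (z ℚ.* ℕ→ℚ T)) (trans (ℚ.*-comm (2^- y) _) (2^-inverse y)) ⟩
  2^- x ℚ.* (ℚ.1ℚ ℚ.* ℕ→ℚ T)                          ≡⟨ cong (2^- x ℚ.*_) (ℚ.*-identityˡ _) ⟩
  2^- x ℚ.* ℕ→ℚ T                                     ∎
  where open ≡-Reasoning

2^*2^-‿cancel : ∀ a b → ℕ→ℚ (2 ^ (a + b)) ℚ.* 2^- b ≡ ℕ→ℚ (2 ^ a)
2^*2^-‿cancel a b = begin
  ℕ→ℚ (2 ^ (a + b)) ℚ.* 2^- b                   ≡⟨ cong (ℚ._* 2^- b) (trans (cong ℕ→ℚ (^-distribˡ-+-* 2 a b)) (ℕ→ℚ-* (2 ^ a) (2 ^ b))) ⟩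
  (ℕ→ℚ (2 ^ a) ℚ.* ℕ→ℚ (2 ^ b)) ℚ.* 2^- b       ≡⟨ ℚ.*-assoc (ℕ→ℚ (2 ^ a)) _ _ ⟩
  ℕ→ℚ (2 ^ a) ℚ.* (ℕ→ℚ (2 ^ b) ℚ.* 2^- b)       ≡⟨ cong (ℕ→ℚ (2 ^ a) ℚ.*_) (2^-inverse b) ⟩
  ℕ→ℚ (2 ^ a) ℚ.* ℚ.1ℚ                          ≡⟨ ℚ.*-identityʳ _ ⟩
  ℕ→ℚ (2 ^ a)                                   ∎
  where open ≡-Reasoning

Agree : ℕ → 𝕡 → 𝕡 → Set
Agree L t t′ = ∀ i → i < L → t i ≡ t′ i

Agree-refl : ∀ {L t} → Agree L t t
Agree-refl _ _ = refl

cons : Bool → 𝕡 → 𝕡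
cons b t zero    = b
cons b t (suc i) = t i

Agree-cons : ∀ L b {t t′} → Agree L t t′ → Agree (suc L) (cons b t) (cons b t′)
Agree-cons L b t≈t′ zero    _         = refl
Agree-cons L b t≈t′ (suc i) (s≤s i<L) = t≈t′ i i<L

ext-∷ : ∀ b (a : Vec Bool n) i → ext (b ∷ a) i ≡ cons b (ext a) i
ext-∷ b a zero    = refl
ext-∷ b a (suc i) = refl

∑-const : ∀ N c → ∑ N (λ _ → c) ≡ 2 ^ N * c
∑-const zero    c = sym (+-identityʳ c)
∑-const (suc N) c = trans (∑-const N (c + c)) (rearrange (2 ^ N) c)
  where
  rearrange : ∀ x c → x * (c + c) ≡ 2 * x * c
  rearrange = solve-∀ ℕ-ring

∑-ext : ∀ L N (F : 𝕡 → ℕ) → (∀ {t t′} → Agree L t t′ → F t ≡ F t′) → L ≤ N →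
        ∑ N (F ∘ ext) ≡ 2 ^ (N ∸ L) * ∑ L (F ∘ ext)
∑-ext zero    N       F F-resp _ = trans (cubeFold-cong N (λ _ → F-resp (λ _ ()))) (∑-const N (F (ext [])))
∑-ext (suc L) (suc N) F F-resp (s≤s L≤N) = begin
  ∑ N (λ a → F (ext (false ∷ a)) + F (ext (true ∷ a)))
    ≡⟨ cubeFold-cong N (λ a → cong₂ _+_ (peel false a) (peel true a)) ⟩
  ∑ N (λ a → F₀ (ext a) + F₁ (ext a))
    ≡⟨ ∑-distrib N _ _ ⟩
  ∑ N (F₀ ∘ ext) + ∑ N (F₁ ∘ ext)
    ≡⟨ cong₂ _+_ (∑-ext L N F₀ (F-resp ∘ Agree-cons L false) L≤N) (∑-ext L N F₁ (F-resp ∘ Agree-cons L true) L≤N) ⟩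
  e * ∑ L (F₀ ∘ ext) + e * ∑ L (F₁ ∘ ext)
    ≡⟨ sym (*-distribˡ-+ e _ _) ⟩
  e * (∑ L (F₀ ∘ ext) + ∑ L (F₁ ∘ ext))
    ≡⟨ cong (e *_) (sym (∑-distrib L _ _)) ⟩
  e * ∑ L (λ a → F₀ (ext a) + F₁ (ext a))
    ≡⟨ cong (e *_) (cubeFold-cong L (λ a → sym (cong₂ _+_ (peel false a) (peel true a)))) ⟩
  e * ∑ L (λ a → F (ext (false ∷ a)) + F (ext (true ∷ a)))
    ∎
  where
  open ≡-Reasoning
  e = 2 ^ (N ∸ L)
  F₀ F₁ : 𝕡 → ℕ
  F₀ = F ∘ cons false
  F₁ = F ∘ cons true
  peel : ∀ {n} b (a : Vec Bool n) → F (ext (b ∷ a)) ≡ F (cons b (ext a))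
  peel b a = F-resp (λ i _ → ext-∷ b a i)

∑³-ext : ∀ L N (H : 𝕡 → 𝕡 → 𝕡 → ℕ) →
         (∀ {t t′ η η′ ξ ξ′} → Agree L t t′ → Agree L η η′ → Agree L ξ ξ′ → H t η ξ ≡ H t′ η′ ξ′) → L ≤ N →
         ∑³ N (λ a b c → H (ext a) (ext b) (ext c)) ≡ 2 ^ (3 * (N ∸ L)) * ∑³ L (λ a b c → H (ext a) (ext b) (ext c))
∑³-ext L N H H-resp L≤N = begin
  ∑ N (λ a → ∑ N (λ b → ∑ N (λ c → H (ext a) (ext b) (ext c))))
    ≡⟨ cubeFold-cong N (λ a → cubeFold-cong N (λ b → ∑-ext L N _ (H-resp Agree-refl Agree-refl) L≤N)) ⟩
  ∑ N (λ a → ∑ N (λ b → e * ∑ L (λ c → H (ext a) (ext b) (ext c))))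
    ≡⟨ cubeFold-cong N (λ a → ∑-scale N e _) ⟩
  ∑ N (λ a → e * ∑ N (λ b → ∑ L (λ c → H (ext a) (ext b) (ext c))))
    ≡⟨ cubeFold-cong N (λ a → cong (e *_) (∑-ext L N _ (λ η≈η′ → cubeFold-cong L (λ _ → H-resp Agree-refl η≈η′ Agree-refl)) L≤N)) ⟩
  ∑ N (λ a → e * (e * ∑ L (λ b → ∑ L (λ c → H (ext a) (ext b) (ext c)))))
    ≡⟨ trans (∑-scale N e _) (cong (e *_) (∑-scale N e _)) ⟩
  e * (e * ∑ N (λ a → ∑ L (λ b → ∑ L (λ c → H (ext a) (ext b) (ext c)))))
    ≡⟨ cong (λ x → e * (e * x)) (∑-ext L N _ (λ t≈t′ → cubeFold-cong L (λ _ → cubeFold-cong L (λ _ → H-resp t≈t′ Agree-refl Agree-refl))) L≤N) ⟩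
  e * (e * (e * ∑³ L (λ a b c → H (ext a) (ext b) (ext c))))
    ≡⟨ collect e _ ⟩
  e * (e * (e * 1)) * ∑³ L (λ a b c → H (ext a) (ext b) (ext c))
    ≡⟨ cong (_* ∑³ L _) (sym (2^[3s] (N ∸ L))) ⟩
  2 ^ (3 * (N ∸ L)) * ∑³ L (λ a b c → H (ext a) (ext b) (ext c))
    ∎
  where
  open ≡-Reasoning
  e = 2 ^ (N ∸ L)
  collect : ∀ e T → e * (e * (e * T)) ≡ e * (e * (e * 1)) * T
  collect = solve-∀ ℕ-ring

ℕ→ℚ-∑³ : ∀ N (f : Vec Bool N → Vec Bool N → Vec Bool N → ℕ) →
         ℕ→ℚ (∑³ N f) ≡ ℚ∑.∑³ N (λ a b c → ℕ→ℚ (f a b c))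
ℕ→ℚ-∑³ N f = trans (homo N _) (cubeFold-cong N (λ a → trans (homo N _) (cubeFold-cong N (λ b → homo N _))))
  where
  homo : ∀ n (h : Vec Bool n → ℕ) → ℕ→ℚ (∑ n h) ≡ ℚ∑.∑ n (ℕ→ℚ ∘ h)
  homo = cubeFold-homo ℕ→ℚ ℕ→ℚ-+

∫-cylinder : ∀ L N (f : 𝕡 → 𝕡 → 𝕡 → ℚ) (H : 𝕡 → 𝕡 → 𝕡 → ℕ) → (∀ t η ξ → f t η ξ ≡ ℕ→ℚ (H t η ξ)) →
             (∀ {t t′ η η′ ξ ξ′} → Agree L t t′ → Agree L η η′ → Agree L ξ ξ′ → H t η ξ ≡ H t′ η′ ξ′) → L ≤ N →
             ∫ℙ³[ N ] f ≡ 2^- (3 * L) ℚ.* ℕ→ℚ (∑³ L (λ a b c → H (ext a) (ext b) (ext c)))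
∫-cylinder L N f H f≡H H-resp L≤N = begin
  2^- (3 * N) ℚ.* sumℚ values
    ≡⟨ cong (2^- (3 * N) ℚ.*_) (trans (cong sumℚ (sym (List.map-id values))) (ℚ∑.sum-allBits³ N id _)) ⟩
  2^- (3 * N) ℚ.* ℚ∑.∑³ N (λ a b c → f (ext a) (ext b) (ext c))
    ≡⟨ cong (2^- (3 * N) ℚ.*_) (trans (cubeFold-cong N (λ a → cubeFold-cong N (λ b → cubeFold-cong N (λ c → f≡H _ _ _))))
                                      (sym (ℕ→ℚ-∑³ N _))) ⟩
  2^- (3 * N) ℚ.* ℕ→ℚ (∑³ N (λ a b c → H (ext a) (ext b) (ext c)))
    ≡⟨ cong₂ (λ x y → 2^- x ℚ.* ℕ→ℚ y) 3N≡3L+3[N∸L] (∑³-ext L N H H-resp L≤N) ⟩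
  2^- (3 * L + 3 * (N ∸ L)) ℚ.* ℕ→ℚ (2 ^ (3 * (N ∸ L)) * ∑³ L (λ a b c → H (ext a) (ext b) (ext c)))
    ≡⟨ 2^-‿cancel (3 * L) (3 * (N ∸ L)) _ ⟩
  2^- (3 * L) ℚ.* ℕ→ℚ (∑³ L (λ a b c → H (ext a) (ext b) (ext c)))
    ∎
  where
  open ≡-Reasoning
  values : List ℚ
  values = concatMap (λ a → concatMap (λ b → map (λ c → f (ext a) (ext b) (ext c)) (allBits N)) (allBits N)) (allBits N)
  3N≡3L+3[N∸L] : 3 * N ≡ 3 * L + 3 * (N ∸ L)
  3N≡3L+3[N∸L] = trans (cong (3 *_) (sym (m+[n∸m]≡n L≤N))) (*-distribˡ-+ 3 L (N ∸ L))

hankel-Agree : ∀ s k {t t′} → Agree (k + s ∸ 1) t t′ → hankel s k t ≡ hankel s k t′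
hankel-Agree s k t≈t′ = Vec.tabulate-cong (λ i → Vec.tabulate-cong (λ j → t≈t′ _ (index< i j)))
  where
  index< : ∀ {s k} (i : Fin s) (j : Fin k) → toℕ i + toℕ j < k + s ∸ 1
  index< {s} {suc k} i j = subst (toℕ i + toℕ j <_) (+-comm s k) (+-mono-<-≤ (toℕ<n i) (≤-pred (toℕ<n j)))

D-Agree : ∀ s k {t t′ η η′ ξ ξ′} → Agree (k + s ∸ 1) t t′ → Agree (k + s ∸ 1) η η′ → Agree (k + s ∸ 1) ξ ξ′ →
          D s k t η ξ ≡ D s k t′ η′ ξ′
D-Agree s k t≈t′ η≈η′ ξ≈ξ′ =
  cong₂ Vec._++_ (cong₂ Vec._++_ (hankel-Agree s k t≈t′) (hankel-Agree s k η≈η′)) (hankel-Agree s k ξ≈ξ′)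

length-filter-∷ : ∀ (r : A → ℕ) x xs i →
  length (filter (λ y → r y ≟ i) (x ∷ xs)) ≡ 𝟙 (r x ≡ᵇ i) + length (filter (λ y → r y ≟ i) xs)
length-filter-∷ r x xs i with r x ≡ᵇ i
... | true  = refl
... | false = refl

sum-δ : ∀ B r (w : ℕ → ℕ) → r < B → sum (map (λ i → 𝟙 (r ≡ᵇ i) * w i) (upTo B)) ≡ w r
sum-δ B r w r<B = trans (cong sum (List.map-applyUpTo id _ B)) (go B r w r<B)
  where
  go : ∀ B r (w : ℕ → ℕ) → r < B → sum (applyUpTo (λ i → 𝟙 (r ≡ᵇ i) * w i) B) ≡ w r
  go (suc B) zero    w _         = begin
    w 0 + 0 + sum (applyUpTo (λ _ → 0) B)          ≡⟨ cong₂ _+_ (+-identityʳ (w 0)) zeros ⟩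
    w 0 + 0                                        ≡⟨ +-identityʳ (w 0) ⟩
    w 0                                            ∎
    where
    open ≡-Reasoning
    zeros : sum (applyUpTo (λ _ → 0) B) ≡ 0
    zeros = trans (cong sum (sym (List.map-applyUpTo suc (λ _ → 0) B))) (sum-map-ε (applyUpTo suc B))
  go (suc B) (suc r) w (s≤s r<B) = go B r (w ∘ suc) r<B

sum-by-value : ∀ (r : A → ℕ) (w : ℕ → ℕ) B → (∀ x → r x < B) → ∀ xs →
  sum (map (λ i → length (filter (λ x → r x ≟ i) xs) * w i) (upTo B)) ≡ sum (map (w ∘ r) xs)
sum-by-value r w B r<B []       = sum-map-ε (upTo B)
sum-by-value r w B r<B (x ∷ xs) = begin
  sum (map (λ i → length (filter (λ y → r y ≟ i) (x ∷ xs)) * w i) (upTo B))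
    ≡⟨ cong sum (List.map-cong (λ i → trans (cong (_* w i) (length-filter-∷ r x xs i)) (*-distribʳ-+ (w i) (𝟙 (r x ≡ᵇ i)) _)) (upTo B)) ⟩
  sum (map (λ i → 𝟙 (r x ≡ᵇ i) * w i + length (filter (λ y → r y ≟ i) xs) * w i) (upTo B))
    ≡⟨ sum-map-distrib (λ i → 𝟙 (r x ≡ᵇ i) * w i) (λ i → length (filter (λ y → r y ≟ i) xs) * w i) (upTo B) ⟩
  sum (map (λ i → 𝟙 (r x ≡ᵇ i) * w i) (upTo B)) + sum (map (λ i → length (filter (λ y → r y ≟ i) xs) * w i) (upTo B))
    ≡⟨ cong₂ _+_ (sum-δ B (r x) w (r<B x)) (sum-by-value r w B r<B xs) ⟩
  w (r x) + sum (map (w ∘ r) xs)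
    ∎
  where open ≡-Reasoning

rank<1+min : ∀ s k (M : Mat (s + s + s) k) → rank M < suc (3 * s ⊓ k)
rank<1+min s k M = s≤s (⊓-glb (subst (rank M ≤_) (3s≡ s) (rank≤rows M)) (rank≤cols M))
  where
  3s≡ : ∀ s → s + s + s ≡ 3 * s
  3s≡ = solve-∀ ℕ-ring

∑-Γ : ∀ s k (w : ℕ → ℕ) →
      sum (map (λ i → Γ s k i * w i) (upTo (suc (3 * s ⊓ k))))
      ≡ ∑³ (k + s ∸ 1) (λ a b c → w (rank (D s k (ext a) (ext b) (ext c))))
∑-Γ s k w = trans (sum-by-value rank w _ (rank<1+min s k) matrices) (sum-allBits³ L (w ∘ rank) _)
  where
  L = k + s ∸ 1
  matrices : List (Mat (s + s + s) k)
  matrices = concatMap (λ a → concatMap (λ b → map (λ c → D s k (ext a) (ext b) (ext c)) (allBits L)) (allBits L)) (allBits L)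

pos-^ : ∀ a q → (+ a) ℤ.^ q ≡ + (a ^ q)
pos-^ a zero    = refl
pos-^ a (suc q) = trans (cong ((+ a) ℤ.*_) (pos-^ a q)) (sym (ℤ.pos-* a (a ^ q)))

g^q-rank : ∀ k s q t η ξ → ℤ→ℚ (g k s t η ξ ℤ.^ q) ≡ ℕ→ℚ (2 ^ ((3 * s + k ∸ rank (D s k t η ξ)) * q))
g^q-rank k s q t η ξ =
  cong ℤ→ℚ (trans (cong (ℤ._^ q) (g-rank k s t η ξ)) (trans (pos-^ (2 ^ e) q) (cong +_ (^-*-assoc 2 e q))))
  where
  e = 3 * s + k ∸ rank (D s k t η ξ)

∫g^q : ∀ k s q N → k + s ∸ 1 ≤ N →
  ∫ℙ³[ N ] (λ t η ξ → ℤ→ℚ (g k s t η ξ ℤ.^ q))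
  ≡ 2^- (3 * (k + s ∸ 1)) ℚ.* ℕ→ℚ (sum (map (λ i → Γ s k i * 2 ^ ((3 * s + k ∸ i) * q)) (upTo (suc (3 * s ⊓ k)))))
∫g^q k s q N L≤N =
  trans (∫-cylinder L N _ (λ t η ξ → w (rank (D s k t η ξ))) (g^q-rank k s q)
                    (λ t≈ η≈ ξ≈ → cong (w ∘ rank) (D-Agree s k t≈ η≈ ξ≈)) L≤N)
        (cong (λ x → 2^- (3 * L) ℚ.* ℕ→ℚ x) (sym (∑-Γ s k w)))
  where
  L = k + s ∸ 1
  w : ℕ → ℕ
  w i = 2 ^ ((3 * s + k ∸ i) * q)

rescale-2^-weights : ∀ P q B (c : ℕ → ℕ) → B ≤ suc P →
  ℕ→ℚ (2 ^ (P * q)) ℚ.* sumℚ (map (λ i → ℕ→ℚ (c i) ℚ.* 2^- (q * i)) (upTo B))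
  ≡ ℕ→ℚ (sum (map (λ i → c i * 2 ^ ((P ∸ i) * q)) (upTo B)))
rescale-2^-weights P q B c B≤1+P = begin
  x ℚ.* sumℚ (map φ (upTo B))               ≡⟨ foldr-homo (x ℚ.*_) (ℚ.*-zeroʳ x) (ℚ.*-distribˡ-+ x) (map φ (upTo B)) ⟩
  sumℚ (map (x ℚ.*_) (map φ (upTo B)))      ≡⟨ cong sumℚ (sym (List.map-∘ (upTo B))) ⟩
  sumℚ (map (λ i → x ℚ.* φ i) (upTo B))     ≡⟨ cong sumℚ (List.map-cong-local (applyUpTo⁺₁ id B pointwise)) ⟩
  sumℚ (map (ℕ→ℚ ∘ ψ) (upTo B))             ≡⟨ cong sumℚ (List.map-∘ (upTo B)) ⟩
  sumℚ (map ℕ→ℚ (map ψ (upTo B)))           ≡⟨ sym (foldr-homo ℕ→ℚ refl ℕ→ℚ-+ (map ψ (upTo B))) ⟩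
  ℕ→ℚ (sum (map ψ (upTo B)))                ∎
  where
  open ≡-Reasoning
  x = ℕ→ℚ (2 ^ (P * q))
  φ : ℕ → ℚ
  φ i = ℕ→ℚ (c i) ℚ.* 2^- (q * i)
  ψ : ℕ → ℕ
  ψ i = c i * 2 ^ ((P ∸ i) * q)
  pointwise : ∀ {i} → i < B → x ℚ.* φ i ≡ ℕ→ℚ (ψ i)
  pointwise {i} i<B = begin
    x ℚ.* (ℕ→ℚ (c i) ℚ.* 2^- (q * i))                          ≡⟨ x∙yz≈y∙xz x (ℕ→ℚ (c i)) _ ⟩
    ℕ→ℚ (c i) ℚ.* (ℕ→ℚ (2 ^ (P * q)) ℚ.* 2^- (q * i))          ≡⟨ cong (λ e → ℕ→ℚ (c i) ℚ.* (ℕ→ℚ (2 ^ e) ℚ.* 2^- (q * i))) split ⟩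
    ℕ→ℚ (c i) ℚ.* (ℕ→ℚ (2 ^ ((P ∸ i) * q + q * i)) ℚ.* 2^- (q * i)) ≡⟨ cong (ℕ→ℚ (c i) ℚ.*_) (2^*2^-‿cancel ((P ∸ i) * q) (q * i)) ⟩
    ℕ→ℚ (c i) ℚ.* ℕ→ℚ (2 ^ ((P ∸ i) * q))                      ≡⟨ sym (ℕ→ℚ-* (c i) _) ⟩
    ℕ→ℚ (ψ i)                                                   ∎
    where
    split : P * q ≡ (P ∸ i) * q + q * i
    split = trans (cong (_* q) (sym (m∸n+n≡m (≤-pred (≤-trans i<B B≤1+P)))))
                  (trans (*-distribʳ-+ q (P ∸ i) i) (cong (λ y → (P ∸ i) * q + y) (*-comm i q)))

3[k+s∸1] : ∀ k s → 3 * (k + s ∸ 1) ≡ 3 * k + 3 * s ∸ 3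
3[k+s∸1] k s = trans (*-distribˡ-∸ 3 (k + s) 1) (cong (_∸ 3) (*-distribˡ-+ 3 k s))

theorem3p3 : (k s q : ℕ) → 1 ≤ k → 1 ≤ s → 1 ≤ q →
    ((t η ξ : 𝕡) → g k s t η ξ ≡ + (2 ^ (3 * s + k ∸ rank (D s k t η ξ))))
    × ((N : ℕ) → k + s ∸ 1 ≤ N →
        ∫ℙ³[ N ] (λ t η ξ → ℤ→ℚ (g k s t η ξ ℤ.^ q))
        ≡ ℕ→ℚ (2 ^ ((3 * s + k) * q)) ℚ.* (2^- (3 * k + 3 * s ∸ 3) ℚ.*
            sumℚ (map (λ i → ℕ→ℚ (Γ s k i) ℚ.* 2^- (q * i)) (upTo (suc (3 * s ⊓ k))))))
theorem3p3 k s q _ _ _ = g-rank k s , λ N L≤N → begin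
  ∫ℙ³[ N ] (λ t η ξ → ℤ→ℚ (g k s t η ξ ℤ.^ q))
    ≡⟨ ∫g^q k s q N L≤N ⟩
  2^- (3 * (k + s ∸ 1)) ℚ.* ℕ→ℚ (sum (map (λ i → Γ s k i * 2 ^ ((P ∸ i) * q)) (upTo R)))
    ≡⟨ cong₂ (λ e y → 2^- e ℚ.* y) (3[k+s∸1] k s) (sym (rescale-2^-weights P q R (Γ s k) R≤1+P)) ⟩
  2^- (3 * k + 3 * s ∸ 3) ℚ.* (ℕ→ℚ (2 ^ (P * q)) ℚ.* sumℚ (map (λ i → ℕ→ℚ (Γ s k i) ℚ.* 2^- (q * i)) (upTo R)))
    ≡⟨ x∙yz≈y∙xz (2^- (3 * k + 3 * s ∸ 3)) (ℕ→ℚ (2 ^ (P * q))) _ ⟩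
  ℕ→ℚ (2 ^ (P * q)) ℚ.* (2^- (3 * k + 3 * s ∸ 3) ℚ.* sumℚ (map (λ i → ℕ→ℚ (Γ s k i) ℚ.* 2^- (q * i)) (upTo R)))
    ∎
  where
  open ≡-Reasoning
  P = 3 * s + k
  R = suc (3 * s ⊓ k)
  R≤1+P : R ≤ suc P
  R≤1+P = s≤s (≤-trans (m⊓n≤m (3 * s) k) (m≤m+n (3 * s) k))
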